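{- Let $A$ be a commutative ring with $1$ and $M \in \operatorname{Sym}_n(A)$. Then the subset $\Sigma(M)\subseteq A^n$ is an $A$-submodule of $A^n$.
   Context: $\operatorname{Sym}_n(A)$ is the set of symmetric $n\times n$ matrices over $A$. $\Sigma A^2$ denotes the set of finite sums of squares of elements of $A$. A matrix $N\in\operatorname{Sym}_n(A)$ is called a sum of squares if $N=Q^tQ$ for some $Q\in\operatorname{Mat}_{m,n}(A)$ and some $m$ (equivalently, $N$ is a finite sum of matrices $w^tw$ with $w\in A^n$ a row vector). For $M\in\operatorname{Sym}_n(A)$, $\Sigma(M)$ is the set of all $v\in A^n$ (viewed as row vectors, so that $v^tv$ is the $n\times n$ matrix $(v_iv_j)_{i,j}$) such that $sM = v^tv + N$ for some $s\in\Sigma A^2$ and some $N\in\operatorname{Sym}_n(A)$ that is a sum of squares. -}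

module Defs where

open import Level using (Level; _⊔_)
open import Algebra.Bundles using (CommutativeRing)
open import Data.Nat.Base using (ℕ)
open import Data.Fin.Base using (Fin)
open import Data.Product using (Σ; ∃; _×_)
import Algebra.Definitions.RawMonoid as RawMonoidDefs

module _ {c ℓ : Level} (R : CommutativeRing c ℓ) where
  open CommutativeRing R
  open RawMonoidDefs +-rawMonoid using (sum)

  Mat : ℕ → Set c
  Mat n = Fin n → Fin n → Carrier

  Row : ℕ → Set c
  Row n = Fin n → Carrier

  IsSymmetric : ∀ {n} → Mat n → Set ℓ
  IsSymmetric M = ∀ i j → M i j ≈ M j i

  IsSumOfSquares : Carrier → Set (c ⊔ ℓ)
  IsSumOfSquares s = ∃ λ (m : ℕ) → Σ (Fin m → Carrier) λ a →
    s ≈ sum (λ k → a k * a k)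

  IsSOSMatrix : ∀ {n} → Mat n → Set (c ⊔ ℓ)
  IsSOSMatrix {n} N = ∃ λ (m : ℕ) → Σ (Fin m → Fin n → Carrier) λ Q →
    ∀ i j → N i j ≈ sum (λ k → Q k i * Q k j)

  InSigma : ∀ {n} → Mat n → Row n → Set (c ⊔ ℓ)
  InSigma {n} M v = Σ Carrier λ s → Σ (Mat n) λ N →
    IsSumOfSquares s × IsSOSMatrix N × (∀ i j → s * M i j ≈ v i * v j + N i j)

  IsSubmodule : ∀ {n} {p} → (Row n → Set p) → Set (c ⊔ p)
  IsSubmodule {n} P =
    P (λ _ → 0#)
    × (∀ u v → P u → P v → P (λ i → u i + v i))
    × (∀ (a : Carrier) v → P v → P (λ i → a * v i))

{-# OPTIONS --safe #-}
module Submission where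

open import Defs
open import Level using (Level)
open import Algebra.Bundles using (Monoid; Ring; CommutativeRing)
open import Data.Nat.Base using (ℕ; zero; suc)
open import Data.Fin.Base using (Fin; splitAt)
open import Data.Product using (_,_)
open import Data.Sum.Properties using ([,]-map; [,]-∘)
open import Data.Vec.Functional using (Vector; _++_)
open import Function.Base using (_∘_)
import Algebra.Properties.AbelianGroup as AbelianGroupProperties
import Algebra.Properties.CommutativeSemigroup as CommutativeSemigroupProperties
import Algebra.Properties.Monoid.Sum as MonoidSum
import Algebra.Properties.RingWithoutOne as RingWithoutOneProperties
import Algebra.Properties.Semiring.Sum as SemiringSum
import Algebra.Solver.Ring.NaturalCoefficients.Default as NaturalCoefficientsSolver
import Relation.Binary.Reasoning.Setoid as SetoidReasoning

-- Sums of squares in A and sums-of-squares matrices QᵗQ are closed under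
-- addition (concatenate the squared terms) and under scaling by a square a².
-- Hence Σ(M) contains 0, is closed under v ↦ a v (multiply the witness
-- s M = vᵗv + N by a²), and under addition by the parallelogram identity
--   2(s + t) M = (u + v)ᵗ(u + v) + (u − v)ᵗ(u − v) + 2 N + 2 N'.

module _ {a ℓ : Level} (M : Monoid a ℓ) where
  open Monoid M
  open MonoidSum M using (sum; sum-cong-≋)
  open SetoidReasoning setoid

  sum-++ : ∀ {m k} (xs : Vector Carrier m) (ys : Vector Carrier k) →
           sum (xs ++ ys) ≈ sum xs ∙ sum ys
  sum-++ {zero}  xs ys = sym (identityˡ (sum ys))
  sum-++ {suc m} xs ys = begin
    xs Fin.zero ∙ sum ((xs ++ ys) ∘ Fin.suc)
      ≈⟨ ∙-congˡ (sum-cong-≋ (λ i → reflexive ([,]-map (splitAt m i)))) ⟩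
    xs Fin.zero ∙ sum ((xs ∘ Fin.suc) ++ ys)
      ≈⟨ ∙-congˡ (sum-++ (xs ∘ Fin.suc) ys) ⟩
    xs Fin.zero ∙ (sum (xs ∘ Fin.suc) ∙ sum ys)
      ≈⟨ assoc _ _ _ ⟨
    sum xs ∙ sum ys ∎

  sum-∘-++ : ∀ {b} {X : Set b} {m k} (f : X → Carrier) (xs : Vector X m) (ys : Vector X k) →
             sum (f ∘ (xs ++ ys)) ≈ sum (f ∘ xs) ∙ sum (f ∘ ys)
  sum-∘-++ {m = m} f xs ys =
    trans (sum-cong-≋ (λ i → reflexive ([,]-∘ f (splitAt m i)))) (sum-++ (f ∘ xs) (f ∘ ys))

module _ {c ℓ : Level} (R : CommutativeRing c ℓ) where
  open CommutativeRing R hiding (zero)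
  open SemiringSum semiring using (sum; sum-cong-≋; *-distribˡ-sum)
  open RingWithoutOneProperties (Ring.ringWithoutOne ring) using (-‿distribˡ-*; -‿distribʳ-*; -‿involutive)
  open AbelianGroupProperties +-abelianGroup using (⁻¹-∙-comm)
  open CommutativeSemigroupProperties +-commutativeSemigroup using () renaming (interchange to +-interchange)
  open CommutativeSemigroupProperties *-commutativeSemigroup using () renaming (interchange to *-interchange)
  open NaturalCoefficientsSolver commutativeSemiring using (solve; _:=_; _:+_; _:*_)
  open SetoidReasoning setoid

  outer : ∀ {n} → Row R n → Mat R n
  outer v i j = v i * v j

  _+ᴹ_ : ∀ {n} → Mat R n → Mat R n → Mat R n
  (N +ᴹ N′) i j = N i j + N′ i j

  _*ᴹ_ : ∀ {n} → Carrier → Mat R n → Mat R n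
  (a *ᴹ N) i j = a * N i j

  foil : ∀ a b c d → (a + c) * (b + d) ≈ (a * b + c * d) + (a * d + c * b)
  foil = solve 4 (λ a b c d → (a :+ c) :* (b :+ d) := (a :* b :+ c :* d) :+ (a :* d :+ c :* b)) refl

  -x*-y≈x*y : ∀ x y → - x * - y ≈ x * y
  -x*-y≈x*y x y = begin
    - x * - y     ≈⟨ -‿distribˡ-* x (- y) ⟨
    - (x * - y)   ≈⟨ -‿cong (-‿distribʳ-* x y) ⟨
    - (- (x * y)) ≈⟨ -‿involutive (x * y) ⟩
    x * y         ∎

  foil-minus : ∀ a b c d → (a - c) * (b - d) ≈ (a * b + c * d) - (a * d + c * b)
  foil-minus a b c d = begin
    (a - c) * (b - d)                         ≈⟨ foil a b (- c) (- d) ⟩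
    (a * b + - c * - d) + (a * - d + - c * b) ≈⟨ +-cong (+-congˡ (-x*-y≈x*y c d))
                                                        (+-cong (sym (-‿distribʳ-* a d)) (sym (-‿distribˡ-* c b))) ⟩
    (a * b + c * d) + (- (a * d) + - (c * b)) ≈⟨ +-congˡ (⁻¹-∙-comm (a * d) (c * b)) ⟩
    (a * b + c * d) - (a * d + c * b)         ∎

  x+y+[x-y]≈x+x : ∀ x y → (x + y) + (x - y) ≈ x + x
  x+y+[x-y]≈x+x x y = begin
    (x + y) + (x - y) ≈⟨ +-interchange x y x (- y) ⟩
    (x + x) + (y - y) ≈⟨ +-congˡ (-‿inverseʳ y) ⟩
    (x + x) + 0#      ≈⟨ +-identityʳ (x + x) ⟩
    x + x             ∎

  parallelogram : ∀ a b c d →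
                  (a + c) * (b + d) + (a - c) * (b - d) ≈ (a * b + a * b) + (c * d + c * d)
  parallelogram a b c d = begin
    (a + c) * (b + d) + (a - c) * (b - d)
      ≈⟨ +-cong (foil a b c d) (foil-minus a b c d) ⟩
    (a * b + c * d + (a * d + c * b)) + (a * b + c * d - (a * d + c * b))
      ≈⟨ x+y+[x-y]≈x+x (a * b + c * d) (a * d + c * b) ⟩
    (a * b + c * d) + (a * b + c * d)
      ≈⟨ +-interchange (a * b) (c * d) (a * b) (c * d) ⟩
    (a * b + a * b) + (c * d + c * d) ∎

  sum-*-square : ∀ {m} a (x y : Vector Carrier m) →
                 (a * a) * sum (λ k → x k * y k) ≈ sum (λ k → (a * x k) * (a * y k))
  sum-*-square a x y =
    trans (*-distribˡ-sum (a * a) (λ k → x k * y k)) (sum-cong-≋ (λ k → *-interchange a a (x k) (y k)))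

  sos-0# : IsSumOfSquares R 0#
  sos-0# = 0 , (λ ()) , refl

  sos-+ : ∀ {s t} → IsSumOfSquares R s → IsSumOfSquares R t → IsSumOfSquares R (s + t)
  sos-+ (_ , x , s≈) (_ , y , t≈) =
    _ , x ++ y , trans (+-cong s≈ t≈) (sym (sum-∘-++ +-monoid (λ z → z * z) x y))

  sos-*-square : ∀ {s} a → IsSumOfSquares R s → IsSumOfSquares R ((a * a) * s)
  sos-*-square a (m , x , s≈) = m , (λ k → a * x k) , trans (*-congˡ s≈) (sum-*-square a x x)

  module _ {n : ℕ} where

    sosMatrix-0 : IsSOSMatrix R {n} (λ _ _ → 0#)
    sosMatrix-0 = 0 , (λ ()) , λ _ _ → refl

    sosMatrix-outer : ∀ w → IsSOSMatrix R {n} (outer w)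
    sosMatrix-outer w = 1 , (λ _ → w) , λ i j → sym (+-identityʳ (w i * w j))

    sosMatrix-+ : ∀ {N N′} → IsSOSMatrix R N → IsSOSMatrix R N′ → IsSOSMatrix R {n} (N +ᴹ N′)
    sosMatrix-+ (_ , P , N≈) (_ , Q , N′≈) = _ , P ++ Q , λ i j →
      trans (+-cong (N≈ i j) (N′≈ i j)) (sym (sum-∘-++ +-monoid (λ r → r i * r j) P Q))

    sosMatrix-*-square : ∀ {N} a → IsSOSMatrix R N → IsSOSMatrix R {n} ((a * a) *ᴹ N)
    sosMatrix-*-square a (m , Q , N≈) = m , (λ k i → a * Q k i) , λ i j →
      trans (*-congˡ (N≈ i j)) (sum-*-square a (λ k → Q k i) (λ k → Q k j))

  module _ {n : ℕ} (M : Mat R n) where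

    inSigma-0 : InSigma R M (λ _ → 0#)
    inSigma-0 = 0# , (λ _ _ → 0#) , sos-0# , sosMatrix-0 , λ i j → begin
      0# * M i j ≈⟨ zeroˡ (M i j) ⟩
      0#         ≈⟨ zeroˡ 0# ⟨
      0# * 0#    ≈⟨ +-identityʳ (0# * 0#) ⟨
      0# * 0# + 0# ∎

    inSigma-* : ∀ a {v} → InSigma R M v → InSigma R M (λ i → a * v i)
    inSigma-* a {v} (s , N , s-sos , N-sos , sM≈) =
      (a * a) * s , (a * a) *ᴹ N , sos-*-square a s-sos , sosMatrix-*-square a N-sos , λ i j → begin
        ((a * a) * s) * M i j                   ≈⟨ *-assoc (a * a) s (M i j) ⟩
        (a * a) * (s * M i j)                   ≈⟨ *-congˡ (sM≈ i j) ⟩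
        (a * a) * (v i * v j + N i j)           ≈⟨ distribˡ (a * a) (v i * v j) (N i j) ⟩
        (a * a) * (v i * v j) + (a * a) * N i j ≈⟨ +-congʳ (*-interchange a a (v i) (v j)) ⟩
        (a * v i) * (a * v j) + (a * a) * N i j ∎

    inSigma-+ : ∀ {u v} → InSigma R M u → InSigma R M v → InSigma R M (λ i → u i + v i)
    inSigma-+ {u} {v} (s , N , s-sos , N-sos , sM≈) (t , N′ , t-sos , N′-sos , tM≈) =
      (s + s) + (t + t) , outer (λ i → u i - v i) +ᴹ ((N +ᴹ N) +ᴹ (N′ +ᴹ N′)) ,
      sos-+ (sos-+ s-sos s-sos) (sos-+ t-sos t-sos) ,
      sosMatrix-+ (sosMatrix-outer _) (sosMatrix-+ (sosMatrix-+ N-sos N-sos) (sosMatrix-+ N′-sos N′-sos)) ,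
      λ i j → begin
        ((s + s) + (t + t)) * M i j
          ≈⟨ trans (distribʳ (M i j) _ _) (+-cong (distribʳ (M i j) s s) (distribʳ (M i j) t t)) ⟩
        (s * M i j + s * M i j) + (t * M i j + t * M i j)
          ≈⟨ +-cong (+-cong (sM≈ i j) (sM≈ i j)) (+-cong (tM≈ i j) (tM≈ i j)) ⟩
        ((u i * u j + N i j) + (u i * u j + N i j)) + ((v i * v j + N′ i j) + (v i * v j + N′ i j))
          ≈⟨ trans (+-cong (+-interchange _ _ _ _) (+-interchange _ _ _ _)) (+-interchange _ _ _ _) ⟩
        ((u i * u j + u i * u j) + (v i * v j + v i * v j)) + ((N i j + N i j) + (N′ i j + N′ i j))
          ≈⟨ +-congʳ (parallelogram (u i) (u j) (v i) (v j)) ⟨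
        ((u i + v i) * (u j + v j) + (u i - v i) * (u j - v j)) + ((N i j + N i j) + (N′ i j + N′ i j))
          ≈⟨ +-assoc _ _ _ ⟩
        (u i + v i) * (u j + v j) + ((u i - v i) * (u j - v j) + ((N i j + N i j) + (N′ i j + N′ i j))) ∎

lemma3p7 : ∀ {c ℓ : Level} (R : CommutativeRing c ℓ) (n : ℕ) (M : Mat R n) →
             IsSymmetric R M → IsSubmodule R (InSigma R M)
lemma3p7 R n M _ = inSigma-0 R M , (λ _ _ → inSigma-+ R M) , (λ a _ → inSigma-* R M a)
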